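{- Let $r,w$ be positive integers. If for a graph $G$ the function $\lambda_G$ has a $(w,r)$-decomposition, then $G$ has tree-depth at most $(2w-1)r+1$.
   Context: Graphs may have loops and parallel edges. For a graph $G=(V,E)$ and $X\subseteq E$, $\lambda_G(X)$ is the number of vertices incident with both an edge in $X$ and an edge in $E\setminus X$. A decomposition of $\lambda_G$ is a pair $(T,\sigma)$, $T$ a tree with at least one internal node and $\sigma$ a bijection from $E$ to the leaves of $T$; for an internal node $v$ the components of $T-v$ induce a partition $\mathcal P_v$ of $E$, the width of $v$ is $\max_{\mathcal P'\subseteq\mathcal P_v}\lambda_G(\bigcup_{X\in\mathcal P'}X)$, the width of $(T,\sigma)$ is the maximum over internal nodes, and its radius is the minimum $r$ such that some node is within distance $r$ of every node. A $(w,r)$-decomposition has width $\le w$ and radius $\le r$. Tree-depth: the closure of a rooted forest is the simple graph on its vertices where two vertices are adjacent iff one is reachable from the other by a directed path (edges oriented away from roots); its height is the number of vertices of a longest directed path; the tree-depth of $G$ is the minimum height of a rooted forest whose closure contains the simplification of $G$ as a subgraph. -}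

module Defs where

open import Data.Nat using (ℕ; zero; suc; _≤_; _<_; _+_)
open import Data.Fin using (Fin; toℕ; _≟_) renaming (zero to fzero; suc to fsuc)
open import Data.Bool using (Bool; true; false; _∧_; _∨_; not; if_then_else_)
open import Data.List using (List; allFin)
open import Data.Bool.ListAction using (any)
open import Data.Product using (Σ; ∃; _×_; _,_; proj₁; proj₂)
open import Data.Sum using (_⊎_)
open import Data.Maybe using (Maybe; just; nothing)
open import Data.Unit using (⊤)
open import Relation.Nullary using (¬_; does)
open import Relation.Binary.PropositionalEquality using (_≡_; _≢_)
open import Function.Definitions using (Injective)

-- Finite graphs, loops and parallel edges allowed.
-- Vertices Fin n, edges Fin m; each edge has two (possibly equal) ends.

record Graph : Set where
  field
    nV    : ℕ
    nE    : ℕ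
    ends  : Fin nE → Fin nV × Fin nV

open Graph public

incidentᵇ : (G : Graph) → Fin (nV G) → Fin (nE G) → Bool
incidentᵇ G v e = does (proj₁ (ends G e) ≟ v) ∨ does (proj₂ (ends G e) ≟ v)

EdgeSet : Graph → Set
EdgeSet G = Fin (nE G) → Bool

countᵇ : (k : ℕ) → (Fin k → Bool) → ℕ
countᵇ zero p = 0
countᵇ (suc k) p = (if p fzero then 1 else 0) + countᵇ k (λ i → p (fsuc i))

λG : (G : Graph) → EdgeSet G → ℕ
λG G X = countᵇ (nV G) (λ v →
            any (λ e → incidentᵇ G v e ∧ X e) (allFin (nE G))
          ∧ any (λ e → incidentᵇ G v e ∧ not (X e)) (allFin (nE G)))

-- Every finite tree is isomorphic to one on the node set
-- Fin (suc k) in which node (suc i) has a parent of index ≤ i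
-- (e.g. a BFS numbering); the tree edges are exactly {suc i , parent i}.

record Tree : Set where
  field
    k        : ℕ
    parent   : Fin k → Fin (suc k)
    parent≤  : ∀ i → toℕ (parent i) ≤ toℕ i

open Tree public

Node : Tree → Set
Node T = Fin (suc (k T))

Adj : (T : Tree) → Node T → Node T → Set
Adj T a b = Σ (Fin (k T)) λ i →
  (a ≡ fsuc i × b ≡ parent T i) ⊎ (b ≡ fsuc i × a ≡ parent T i)

Leaf : (T : Tree) → Node T → Set
Leaf T a = Σ (Node T) λ b → Adj T a b × (∀ c → Adj T a c → c ≡ b)

Internal : (T : Tree) → Node T → Set
Internal T a = ¬ Leaf T a

data Walk (T : Tree) (P : Node T → Set) : Node T → Node T → ℕ → Set where
  here : ∀ {a} → P a → Walk T P a a 0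
  step : ∀ {a b c n} → P a → Adj T a b → Walk T P b c n → Walk T P a c (suc n)

SameComp : (T : Tree) → Node T → Node T → Node T → Set
SameComp T v a b = ∃ λ n → Walk T (λ x → x ≢ v) a b n

RadiusAtMost : Tree → ℕ → Set
RadiusAtMost T r = Σ (Node T) λ c → ∀ u → ∃ λ n → n ≤ r × Walk T (λ _ → ⊤) c u n

record Decomposition (G : Graph) : Set where
  field
    tree         : Tree
    hasInternal  : Σ (Node tree) (Internal tree)
    σ            : Fin (nE G) → Node tree
    σ-injective  : Injective _≡_ _≡_ σ
    σ-leaf       : ∀ e → Leaf tree (σ e)
    σ-onto       : ∀ a → Leaf tree a → Σ (Fin (nE G)) λ e → σ e ≡ a

open Decomposition public

-- width of an internal node v is ≤ w: every union X of parts of the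
-- partition P_v (i.e. every edge set that is a union of the classes
-- "σ e lies in a given component of T - v") has λ_G(X) ≤ w
NodeWidthAtMost : (G : Graph) (D : Decomposition G) → Node (tree D) → ℕ → Set
NodeWidthAtMost G D v w =
  ∀ (X : EdgeSet G) →
    (∀ e e′ → SameComp (tree D) v (σ D e) (σ D e′) → X e ≡ X e′) →
    λG G X ≤ w

IsWRDecomposition : (G : Graph) → Decomposition G → ℕ → ℕ → Set
IsWRDecomposition G D w r =
  (∀ v → Internal (tree D) v → NodeWidthAtMost G D v w) × RadiusAtMost (tree D) r

HasWRDecomposition : Graph → ℕ → ℕ → Set
HasWRDecomposition G w r = Σ (Decomposition G) λ D → IsWRDecomposition G D w r

-- Rooted forests and tree-depth. Every finite rooted forest is isomorphic
-- to one on Fin p in which each parent has smaller index than its child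
-- (roots are the nodes without parent).

record Forest : Set where
  field
    p       : ℕ
    fpar    : Fin p → Maybe (Fin p)
    fpar<   : ∀ i j → fpar i ≡ just j → toℕ j < toℕ i

open Forest public

-- Up F a c n : c is reached from a by going up n parent steps,
-- i.e. there is a directed path (away from roots) from c to a with n edges
data Up (F : Forest) : Fin (p F) → Fin (p F) → ℕ → Set where
  up0 : ∀ {a} → Up F a a 0
  up1 : ∀ {a b c n} → fpar F a ≡ just b → Up F b c n → Up F a c (suc n)

HeightAtMost : Forest → ℕ → Set
HeightAtMost F d = ∀ a c n → Up F a c n → suc n ≤ d

ClosureAdj : (F : Forest) → Fin (p F) → Fin (p F) → Set
ClosureAdj F a b = a ≢ b × ∃ λ n → Up F a b n ⊎ Up F b a n

-- the simplification of G is a subgraph of the closure of F, where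
-- V(G) is identified with a subset of the vertices of F via f
SimplificationEmbeds : (G : Graph) (F : Forest) → (Fin (nV G) → Fin (p F)) → Set
SimplificationEmbeds G F f =
  Injective _≡_ _≡_ f ×
  (∀ e → proj₁ (ends G e) ≢ proj₂ (ends G e) →
     ClosureAdj F (f (proj₁ (ends G e))) (f (proj₂ (ends G e))))

TreeDepthAtMost : Graph → ℕ → Set
TreeDepthAtMost G d =
  Σ Forest λ F → HeightAtMost F d × Σ (Fin (nV G) → Fin (p F)) (SimplificationEmbeds G F)

-- Root the decomposition tree at an internal node c within distance r of every node. A hub, a
-- vertex on two distinct edges, is attached to the deepest node lying above the leaves of all its
-- edges; that node is internal, has depth < r, and the hub has edges in two different components
-- of T minus that node. Averaging λ_G over all unions of those components shows that fewer than 2w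
-- hubs are attached to one node, so hubs get distinct ranks depth · (2w − 1) + slot < (2w − 1) r
-- along every root path. Ordering hubs by rank along root paths, hanging every other vertex below
-- the hubs above the leaf of its edge, and letting each edge that meets no other edge form a chain
-- of its own, gives a forest of height at most (2w − 1) r + 1 whose closure contains G.
module Submission where

open import Defs
open import Data.Nat using (ℕ; _≤_; _<_; _+_; _*_; _∸_)

import Data.Nat as ℕ
open import Data.Nat using (zero; suc; z≤n; s≤s; s≤s⁻¹; _<?_; _≤?_; _^_)
open import Data.Nat.Properties
  using (≤-refl; ≤-reflexive; ≤-trans; ≤-antisym; <-trans; ≤-<-trans; <-≤-trans; <⇒≤; <-irrefl; <-asym;
         <-cmp; ≰⇒>; n<1+n; n≤1+n; m≤m+n; m≤n+m; m<m+n; m+1+n≰m; m∸n≤m; ∸-monoʳ-<;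
         suc[m]≤n⇒m≤pred[n]; pred[m∸n]≡m∸[1+n]; +-comm; +-identityʳ; +-suc; +-cancelˡ-≡;
         +-mono-≤; +-monoˡ-≤; +-monoʳ-<; *-comm; *-assoc; *-identityʳ; *-distribˡ-+; *-distribʳ-+;
         *-mono-≤; *-monoˡ-≤; *-monoʳ-≤; +-commutativeSemigroup; module ≤-Reasoning)
open import Algebra.Properties.CommutativeSemigroup +-commutativeSemigroup using (interchange; xy∙z≈xz∙y)
open import Data.Fin using (Fin; toℕ; fromℕ<; combine; remQuot) renaming (zero to fzero; suc to fsuc)
open import Data.Fin.Properties
  using (_≟_; any?; all?; toℕ<n; toℕ-fromℕ<; toℕ-injective; remQuot-combine; combine-remQuot;
         combine-monoˡ-<)
open import Data.Vec.Functional using (_∷_; head; tail)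
open import Data.Bool using (Bool; true; false; T; not; _∧_; if_then_else_)
open import Data.Bool.Properties using (T-∧; T-∨; T-≡; T-not-≡)
open import Data.Bool.ListAction using (any)
open import Data.List using (List; allFin; filter)
open import Data.List.Extrema.Nat using (argmax; argmax-all; f[xs]≤f[argmax])
open import Data.List.Membership.Propositional using (find; lose)
open import Data.List.Membership.Propositional.Properties using (∈-filter⁺; ∈-allFin)
open import Data.List.Relation.Unary.All as All using ()
open import Data.List.Relation.Unary.All.Properties using (all-filter)
open import Data.List.Relation.Unary.Any.Properties using (any⁺; any⁻)
open import Data.Maybe as Maybe using (Maybe; just; nothing; _>>=_)
open import Data.Maybe.Properties using (just-injective) renaming (≡-dec to ≡-dec-Maybe)
open import Data.Product using (Σ; ∃; ∃₂; _×_; _,_; proj₁; proj₂; uncurry)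
open import Data.Sum using (_⊎_; inj₁; inj₂; [_,_])
open import Data.Empty using (⊥; ⊥-elim)
open import Data.Unit using (⊤; tt)
open import Function using (_∘_)
open import Function.Bundles using (Equivalence)
open import Relation.Nullary using (¬_; Dec; yes; no; does; contradiction)
open import Relation.Nullary.Decidable
  using (_×-dec_; _⊎-dec_; _→-dec_; ¬?; T?; ⌊_⌋; dec-true; map′; decidable-stable; toWitness; fromWitness)
open import Relation.Unary using (Pred; Decidable)
open import Relation.Binary.Definitions using (Tri; tri<; tri≈; tri>)
open import Relation.Binary.PropositionalEquality
  using (_≡_; _≢_; refl; sym; trans; cong; subst; subst₂; module ≡-Reasoning)

record Maximum {a} {n : ℕ} (P : Pred (Fin n) a) (f : Fin n → ℕ) : Set a where
  field
    arg     : Fin n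
    holds   : P arg
    maximal : ∀ {j} → P j → f j ≤ f arg

maximum : ∀ {a n} {P : Pred (Fin n) a} → Decidable P → (f : Fin n → ℕ) → ∃ P → Maximum P f
maximum {n = n} P? f (i , pᵢ) = record
  { arg     = argmax f i candidates
  ; holds   = argmax-all f pᵢ (all-filter P? (allFin n))
  ; maximal = λ pⱼ → All.lookup (f[xs]≤f[argmax] {f = f} i candidates) (∈-filter⁺ P? (∈-allFin _) pⱼ)
  }
  where
    candidates : List (Fin n)
    candidates = filter P? (allFin n)

countᵇ-none : ∀ k (p : Fin k → Bool) → (∀ i → ¬ T (p i)) → countᵇ k p ≡ 0
countᵇ-none zero    p none = refl
countᵇ-none (suc k) p none with p fzero in eq
... | true  = contradiction (Equivalence.from T-≡ eq) (none fzero)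
... | false = countᵇ-none k (p ∘ fsuc) (none ∘ fsuc)

countᵇ-mono : ∀ k {p q : Fin k → Bool} → (∀ i → T (p i) → T (q i)) → countᵇ k p ≤ countᵇ k q
countᵇ-mono zero    p⇒q = z≤n
countᵇ-mono (suc k) {p} {q} p⇒q with p fzero in ep | q fzero in eq
... | false | false = countᵇ-mono k (p⇒q ∘ fsuc)
... | false | true  = ≤-trans (countᵇ-mono k (p⇒q ∘ fsuc)) (n≤1+n _)
... | true  | true  = s≤s (countᵇ-mono k (p⇒q ∘ fsuc))
... | true  | false = ⊥-elim (subst T eq (p⇒q fzero (subst T (sym ep) tt)))

countᵇ-strict : ∀ k {p q : Fin k → Bool} → (∀ i → T (p i) → T (q i)) →
                ∀ j → ¬ T (p j) → T (q j) → countᵇ k p < countᵇ k q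
countᵇ-strict (suc k) {p} {q} p⇒q fzero ¬pj qj with p fzero | q fzero
... | false | true  = s≤s (countᵇ-mono k (p⇒q ∘ fsuc))
... | true  | _     = ⊥-elim (¬pj tt)
... | false | false = ⊥-elim qj
countᵇ-strict (suc k) {p} {q} p⇒q (fsuc j) ¬pj qj with p fzero in ep | q fzero in eq
... | false | false = countᵇ-strict k (p⇒q ∘ fsuc) j ¬pj qj
... | false | true  = ≤-trans (countᵇ-strict k (p⇒q ∘ fsuc) j ¬pj qj) (n≤1+n _)
... | true  | true  = s≤s (countᵇ-strict k (p⇒q ∘ fsuc) j ¬pj qj)
... | true  | false = ⊥-elim (subst T eq (p⇒q fzero (subst T (sym ep) tt)))

module _ (G : Graph) where

  Incident : Fin (nV G) → Fin (nE G) → Set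
  Incident v e = T (incidentᵇ G v e)

  Incident? : ∀ v e → Dec (Incident v e)
  Incident? v e = T? (incidentᵇ G v e)

  incident⇒end : ∀ {v e} → Incident v e → proj₁ (ends G e) ≡ v ⊎ proj₂ (ends G e) ≡ v
  incident⇒end {v} {e} ve with proj₁ (ends G e) ≟ v | proj₂ (ends G e) ≟ v
  ... | yes eq | _      = inj₁ eq
  ... | no _   | yes eq = inj₂ eq

  ≟-refl-T : ∀ (x : Fin (nV G)) → T (does (x ≟ x))
  ≟-refl-T x = Equivalence.from T-≡ (dec-true (x ≟ x) refl)

  end₁-incident : ∀ e → Incident (proj₁ (ends G e)) e
  end₁-incident e = Equivalence.from T-∨ (inj₁ (≟-refl-T (proj₁ (ends G e))))

  end₂-incident : ∀ e → Incident (proj₂ (ends G e)) e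
  end₂-incident e = Equivalence.from T-∨ (inj₂ (≟-refl-T (proj₂ (ends G e))))

  -- An edge has at most two ends.
  incident-third : ∀ {u v x e} → Incident u e → Incident v e → Incident x e → u ≢ v → x ≢ v → u ≡ x
  incident-third ue ve xe u≢v x≢v with incident⇒end ue | incident⇒end ve | incident⇒end xe
  ... | inj₁ u₁ | inj₁ v₁ | _       = contradiction (trans (sym u₁) v₁) u≢v
  ... | inj₂ u₂ | inj₂ v₂ | _       = contradiction (trans (sym u₂) v₂) u≢v
  ... | inj₁ u₁ | inj₂ v₂ | inj₁ x₁ = trans (sym u₁) x₁
  ... | inj₁ u₁ | inj₂ v₂ | inj₂ x₂ = contradiction (trans (sym x₂) v₂) x≢v
  ... | inj₂ u₂ | inj₁ v₁ | inj₂ x₂ = trans (sym u₂) x₂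
  ... | inj₂ u₂ | inj₁ v₁ | inj₁ x₁ = contradiction (trans (sym x₁) v₁) x≢v

-- λG G X unfolds to countᵇ (nV G) (boundaryᵇ G X).
boundaryᵇ : (G : Graph) → EdgeSet G → Fin (nV G) → Bool
boundaryᵇ G X v = any (λ e → incidentᵇ G v e ∧ X e) (allFin (nE G))
                ∧ any (λ e → incidentᵇ G v e ∧ not (X e)) (allFin (nE G))

boundary-intro : ∀ G (X : EdgeSet G) {v e e′} → Incident G v e → T (X e) →
                 Incident G v e′ → T (not (X e′)) → T (boundaryᵇ G X v)
boundary-intro G X {v} {e} {e′} ve Xe ve′ ¬Xe′ = Equivalence.from T-∧
  ( any⁺ (λ f → incidentᵇ G v f ∧ X f) (lose (∈-allFin e) (Equivalence.from T-∧ (ve , Xe)))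
  , any⁺ (λ f → incidentᵇ G v f ∧ not (X f)) (lose (∈-allFin e′) (Equivalence.from T-∧ (ve′ , ¬Xe′))))

λG-empty : ∀ G (X : EdgeSet G) → (∀ e → ¬ T (X e)) → λG G X ≡ 0
λG-empty G X none = countᵇ-none (nV G) (boundaryᵇ G X) λ v bd →
  let e , _ , ve∧Xe = find (any⁻ (λ f → incidentᵇ G v f ∧ X f) (allFin (nE G))
                                 (proj₁ (Equivalence.to T-∧ bd)))
  in none e (proj₂ (Equivalence.to T-∧ ve∧Xe))

-- The relation need not be transitive: the forest built from it realises its transitive closure.
record TreeOrder (n H : ℕ) : Set₁ where
  field
    _≺_     : Fin n → Fin n → Set
    _≺?_    : ∀ u v → Dec (u ≺ v)
    rank    : Fin n → ℕ
    rank<   : ∀ v → rank v < H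
    ≺-rank  : ∀ {u v} → u ≺ v → rank u < rank v
    ≺-chain : ∀ {u u′ v} → u ≺ v → u′ ≺ v → u ≺ u′ ⊎ u ≡ u′ ⊎ u′ ≺ u

module ForestOfTreeOrder {n H : ℕ} (O : TreeOrder n H) where

  open TreeOrder O

  data ParentView (v : Fin n) : Maybe (Fin n) → Set where
    root  : (∀ u → ¬ u ≺ v) → ParentView v nothing
    below : ∀ y → y ≺ v → (∀ {u} → u ≺ v → rank u ≤ rank y) → ParentView v (just y)

  parentOf : Fin n → Maybe (Fin n)
  parentOf v with any? (_≺? v)
  ... | yes some = just (Maximum.arg (maximum (_≺? v) rank some))
  ... | no _      = nothing

  parentOf-view : ∀ v → ParentView v (parentOf v)
  parentOf-view v with any? (_≺? v)
  ... | yes some = below _ (Maximum.holds m) (Maximum.maximal m)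
    where
      m : Maximum (_≺ v) rank
      m = maximum (_≺? v) rank some
  ... | no none = root λ u u≺v → none (u , u≺v)

  -- Vertex v becomes forest node (rank v , v); the other nodes of Fin (H * n) are isolated roots.
  node : Fin n → Fin (H * n)
  node v = combine (fromℕ< (rank< v)) v

  level : Fin (H * n) → Fin H
  level i = proj₁ (remQuot n i)

  decode : Fin H × Fin n → Maybe (Fin n)
  decode (q , v) with toℕ q ℕ.≟ rank v
  ... | yes _ = just v
  ... | no _  = nothing

  decode-node : ∀ v → decode (fromℕ< (rank< v) , v) ≡ just v
  decode-node v with toℕ (fromℕ< (rank< v)) ℕ.≟ rank v
  ... | yes _  = refl
  ... | no neq = contradiction (toℕ-fromℕ< (rank< v)) neq

  decode-just : ∀ qv {v} → decode qv ≡ just v → uncurry combine qv ≡ node v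
  decode-just (q , v) eq with toℕ q ℕ.≟ rank v
  decode-just (q , v) refl | yes q≡rank =
    cong (λ q′ → combine q′ v) (toℕ-injective (trans q≡rank (sym (toℕ-fromℕ< (rank< v)))))

  vertexAt : Fin (H * n) → Maybe (Fin n)
  vertexAt i = decode (remQuot n i)

  vertexAt-node : ∀ v → vertexAt (node v) ≡ just v
  vertexAt-node v = trans (cong decode (remQuot-combine (fromℕ< (rank< v)) v)) (decode-node v)

  vertexAt-just : ∀ {i v} → vertexAt i ≡ just v → i ≡ node v
  vertexAt-just {i} eq = trans (sym (combine-remQuot {H} n i)) (decode-just (remQuot n i) eq)

  node-injective : ∀ {u v} → node u ≡ node v → u ≡ v
  node-injective {u} {v} eq = just-injective (begin
    just u          ≡⟨ vertexAt-node u ⟨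
    vertexAt (node u) ≡⟨ cong vertexAt eq ⟩
    vertexAt (node v) ≡⟨ vertexAt-node v ⟩
    just v          ∎)
    where open ≡-Reasoning

  level-node : ∀ v → toℕ (level (node v)) ≡ rank v
  level-node v = trans (cong (toℕ ∘ proj₁) (remQuot-combine (fromℕ< (rank< v)) v)) (toℕ-fromℕ< (rank< v))

  forestParent : Fin (H * n) → Maybe (Fin (H * n))
  forestParent i = Maybe.map node (vertexAt i >>= parentOf)

  forestParent-node : ∀ v → forestParent (node v) ≡ Maybe.map node (parentOf v)
  forestParent-node v rewrite vertexAt-node v = refl

  forestParent-just : ∀ {i j} → forestParent i ≡ just j →
                      ∃₂ λ v y → i ≡ node v × j ≡ node y × y ≺ v
  forestParent-just {i} eq with vertexAt i in at
  ... | just v with parentOf v | parentOf-view v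
  forestParent-just refl | just v | just y | below _ y≺v _ = v , y , vertexAt-just at , refl , y≺v

  forestParent-level : ∀ {i j} → forestParent i ≡ just j → toℕ (level j) < toℕ (level i)
  forestParent-level eq with forestParent-just eq
  ... | v , y , refl , refl , y≺v = subst₂ _<_ (sym (level-node y)) (sym (level-node v)) (≺-rank y≺v)

  forestParent< : ∀ i j → forestParent i ≡ just j → toℕ j < toℕ i
  forestParent< i j eq with forestParent-just eq
  ... | v , y , refl , refl , y≺v = combine-monoˡ-< y v
          (subst₂ _<_ (sym (toℕ-fromℕ< (rank< y))) (sym (toℕ-fromℕ< (rank< v))) (≺-rank y≺v))

  forest : Forest
  forest = record { p = H * n ; fpar = forestParent ; fpar< = forestParent< }

  up-length≤level : ∀ {i j m} → Up forest i j m → m ≤ toℕ (level i)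
  up-length≤level up0 = z≤n
  up-length≤level (up1 i↑ up) = ≤-trans (s≤s (up-length≤level up)) (forestParent-level i↑)

  forest-height : HeightAtMost forest H
  forest-height i j m up = ≤-trans (s≤s (up-length≤level up)) (toℕ<n (level i))

  ≺⇒Up : ∀ b {u v} → rank v < b → u ≺ v → ∃ (Up forest (node v) (node u))
  ≺⇒Up (suc b) {u} {v} rank<b u≺v with parentOf v in eq | parentOf-view v
  ... | nothing | root none = contradiction u≺v (none u)
  ... | just y  | below _ y≺v maximal = extend (≺-chain u≺v y≺v)
    where
      v↑y : forestParent (node v) ≡ just (node y)
      v↑y = trans (forestParent-node v) (cong (Maybe.map node) eq)
      extend : u ≺ y ⊎ u ≡ y ⊎ y ≺ u → ∃ (Up forest (node v) (node u))
      extend (inj₁ u≺y) with ≺⇒Up b (≤-trans (≺-rank y≺v) (s≤s⁻¹ rank<b)) u≺y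
      ... | m , up = suc m , up1 v↑y up
      extend (inj₂ (inj₁ u≡y)) = 1 , subst (λ x → Up forest (node v) (node x) 1) (sym u≡y) (up1 v↑y up0)
      extend (inj₂ (inj₂ y≺u)) = contradiction (≤-<-trans (maximal u≺v) (≺-rank y≺u)) (<-irrefl refl)

treeDepth-of-treeOrder : ∀ (G : Graph) {H} (O : TreeOrder (nV G) H) → let open TreeOrder O in
  (∀ e → proj₁ (ends G e) ≢ proj₂ (ends G e) →
     proj₁ (ends G e) ≺ proj₂ (ends G e) ⊎ proj₂ (ends G e) ≺ proj₁ (ends G e)) →
  TreeDepthAtMost G H
treeDepth-of-treeOrder G O comparable =
  forest , forest-height , node , node-injective , λ e x≢y →
    (λ eq → x≢y (node-injective eq)) , closure (comparable e x≢y)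
  where
    open TreeOrder O using (_≺_)
    open ForestOfTreeOrder O
    closure : ∀ {x y} → x ≺ y ⊎ y ≺ x →
              ∃ λ m → Up forest (node x) (node y) m ⊎ Up forest (node y) (node x) m
    closure (inj₁ x≺y) = let m , up = ≺⇒Up (suc _) (n<1+n _) x≺y in m , inj₂ up
    closure (inj₂ y≺x) = let m , up = ≺⇒Up (suc _) (n<1+n _) y≺x in m , inj₁ up

-- A rooted forest given by parent pointers; the measure, decreasing towards the roots, only
-- serves termination. a ≼ b means that a is an ancestor of b.
module RootedTree {N : ℕ} (up : Fin N → Maybe (Fin N)) (measure : Fin N → ℕ)
  (up-measure : ∀ {u p} → up u ≡ just p → measure p < measure u) where

  infix 4 _≼_

  data _≼_ (a : Fin N) : Fin N → Set where
    here  : a ≼ a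
    there : ∀ {b p} → up b ≡ just p → a ≼ p → a ≼ b

  up-functional : ∀ {u p q} → up u ≡ just p → up u ≡ just q → p ≡ q
  up-functional e e′ = just-injective (trans (sym e) e′)

  ≼-up⁻¹ : ∀ {a b p} → a ≼ b → a ≢ b → up b ≡ just p → a ≼ p
  ≼-up⁻¹ here         a≢b _ = contradiction refl a≢b
  ≼-up⁻¹ (there e a≼) _   e′ = subst (_ ≼_) (up-functional e e′) a≼

  ≼-root⁻¹ : ∀ {a b} → a ≼ b → up b ≡ nothing → a ≡ b
  ≼-root⁻¹ here        _ = refl
  ≼-root⁻¹ (there e _) e′ with () ← trans (sym e) e′

  ≼-trans : ∀ {a b c} → a ≼ b → b ≼ c → a ≼ c
  ≼-trans a≼b here          = a≼b
  ≼-trans a≼b (there e b≼p) = there e (≼-trans a≼b b≼p)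

  ≼?-within : ∀ fuel a b → measure b < fuel → Dec (a ≼ b)
  ≼?-within (suc fuel) a b mb<fuel with a ≟ b
  ... | yes refl = yes here
  ... | no a≢b with up b in eq
  ...   | nothing = no λ a≼b → a≢b (≼-root⁻¹ a≼b eq)
  ...   | just p with ≼?-within fuel a p (≤-trans (up-measure eq) (s≤s⁻¹ mb<fuel))
  ...     | yes a≼p = yes (there eq a≼p)
  ...     | no a⋠p  = no λ a≼b → a⋠p (≼-up⁻¹ a≼b a≢b eq)

  _≼?_ : ∀ a b → Dec (a ≼ b)
  a ≼? b = ≼?-within (suc (measure b)) a b (n<1+n _)

  depthWithin : ℕ → Fin N → ℕ
  depthWithin zero       u = 0
  depthWithin (suc fuel) u with up u
  ... | nothing = 0
  ... | just p  = suc (depthWithin fuel p)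

  depthWithin-stable : ∀ f f′ u → measure u < f → measure u < f′ → depthWithin f u ≡ depthWithin f′ u
  depthWithin-stable (suc f) (suc f′) u mu<f mu<f′ with up u in eq
  ... | nothing = refl
  ... | just p  = cong suc (depthWithin-stable f f′ p (≤-trans (up-measure eq) (s≤s⁻¹ mu<f))
                                                      (≤-trans (up-measure eq) (s≤s⁻¹ mu<f′)))

  depth : Fin N → ℕ
  depth u = depthWithin (suc (measure u)) u

  depth-up : ∀ {u p} → up u ≡ just p → depth u ≡ suc (depth p)
  depth-up {u} {p} eq rewrite eq =
    cong suc (depthWithin-stable (measure u) (suc (measure p)) p (up-measure eq) (n<1+n _))

  depth-root : ∀ {u} → up u ≡ nothing → depth u ≡ 0
  depth-root eq rewrite eq = refl

  up-depth : ∀ {u p} → up u ≡ just p → depth p < depth u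
  up-depth e = ≤-reflexive (sym (depth-up e))

  ≼-depth : ∀ {a b} → a ≼ b → depth a ≤ depth b
  ≼-depth here          = ≤-refl
  ≼-depth (there e a≼p) = ≤-trans (≼-depth a≼p) (<⇒≤ (up-depth e))

  ≼-depth-injective : ∀ {a b} → a ≼ b → depth a ≡ depth b → a ≡ b
  ≼-depth-injective here          _   = refl
  ≼-depth-injective (there e a≼p) eq = ⊥-elim (<-irrefl eq (≤-<-trans (≼-depth a≼p) (up-depth e)))

  ≼-chain : ∀ {a b c} → a ≼ c → b ≼ c → depth a ≤ depth b → a ≼ b
  ≼-chain a≼c here           _  = a≼c
  ≼-chain here (there e b≼p) da≤db =
    ⊥-elim (<-irrefl refl (≤-<-trans da≤db (≤-<-trans (≼-depth b≼p) (up-depth e))))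
  ≼-chain (there e a≼p) (there e′ b≼p′) da≤db =
    ≼-chain (subst (_ ≼_) (up-functional e e′) a≼p) b≼p′ da≤db

  ≼-unique : ∀ {a b c} → a ≼ c → b ≼ c → depth a ≡ depth b → a ≡ b
  ≼-unique a≼c b≼c eq = ≼-depth-injective (≼-chain a≼c b≼c (≤-reflexive eq)) eq

  ≼-child : ∀ {a b} → a ≼ b → a ≢ b → ∃ λ x → up x ≡ just a × x ≼ b
  ≼-child here          a≢b = contradiction refl a≢b
  ≼-child {a} (there {b} {p} e a≼p) _ with a ≟ p
  ... | yes refl = b , e , here
  ... | no a≢p with ≼-child a≼p a≢p
  ...   | x , x↑a , x≼p = x , x↑a , ≼-trans x≼p (there e here)

  root-≼-within : ∀ fuel b → measure b < fuel → ∃ λ a → up a ≡ nothing × a ≼ b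
  root-≼-within (suc fuel) b mb<fuel with up b in eq
  ... | nothing = b , eq , here
  ... | just p with root-≼-within fuel p (≤-trans (up-measure eq) (s≤s⁻¹ mb<fuel))
  ...   | a , root , a≼p = a , root , there eq a≼p

  root-≼ : ∀ b → ∃ λ a → up a ≡ nothing × a ≼ b
  root-≼ b = root-≼-within (suc (measure b)) b (n<1+n _)

  branch : Fin N → Fin N → Maybe (Fin N)
  branch t x with any? (λ a → ≡-dec-Maybe _≟_ (up a) (just t) ×-dec a ≼? x)
  ... | yes (a , _) = just a
  ... | no _        = nothing

  branch-just : ∀ {t x a} → branch t x ≡ just a → up a ≡ just t × a ≼ x
  branch-just {t} {x} eq with any? (λ a → ≡-dec-Maybe _≟_ (up a) (just t) ×-dec a ≼? x)
  branch-just refl | yes (a , a↑t , a≼x) = a↑t , a≼x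

  branch-child : ∀ {t x a} → up a ≡ just t → a ≼ x → branch t x ≡ just a
  branch-child {t} {x} a↑t a≼x with any? (λ a → ≡-dec-Maybe _≟_ (up a) (just t) ×-dec a ≼? x)
  ... | yes (b , b↑t , b≼x) = cong just (≼-unique b≼x a≼x (trans (depth-up b↑t) (sym (depth-up a↑t))))
  ... | no none             = contradiction (_ , a↑t , a≼x) none

  branch-below : ∀ {t x} → t ≼ x → t ≢ x → ∃ λ a → branch t x ≡ just a
  branch-below t≼x t≢x = let a , a↑t , a≼x = ≼-child t≼x t≢x in a , branch-child a↑t a≼x

  branch-cong : ∀ {t x y} → (∀ {a} → up a ≡ just t → a ≼ x → a ≼ y) →
                (∀ {a} → up a ≡ just t → a ≼ y → a ≼ x) → branch t x ≡ branch t y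
  branch-cong {t} {x} {y} x⇒y y⇒x with branch t x in ex | branch t y in ey
  ... | just a  | _       = let a↑t , a≼x = branch-just ex in
                            sym (trans (sym ey) (branch-child a↑t (x⇒y a↑t a≼x)))
  ... | nothing | nothing = refl
  ... | nothing | just b  = let b↑t , b≼y = branch-just ey in
                            trans (sym ex) (branch-child b↑t (y⇒x b↑t b≼y))

  branch-up : ∀ {t x y} → up x ≡ just y → y ≢ t → branch t x ≡ branch t y
  branch-up {t} {x} {y} x↑y y≢t = branch-cong x⇒y (λ _ a≼y → there x↑y a≼y)
    where
      x⇒y : ∀ {a} → up a ≡ just t → a ≼ x → a ≼ y
      x⇒y {a} a↑t a≼x with a ≟ x
      ... | yes refl = contradiction (up-functional x↑y a↑t) y≢t
      ... | no a≢x   = ≼-up⁻¹ a≼x a≢x x↑y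

Adj-sym : ∀ {T a b} → Adj T a b → Adj T b a
Adj-sym (i , inj₁ x) = i , inj₂ x
Adj-sym (i , inj₂ x) = i , inj₁ x

walk-start : ∀ {T P a b n} → Walk T P a b n → P a
walk-start (here Pa)     = Pa
walk-start (step Pa _ _) = Pa

module Rerooted (T : Tree) (c : Node T) where

  up₀ : Node T → Maybe (Node T)
  up₀ fzero    = nothing
  up₀ (fsuc i) = just (parent T i)

  up₀-measure : ∀ {u p} → up₀ u ≡ just p → toℕ p < toℕ u
  up₀-measure {fsuc i} refl = s≤s (parent≤ T i)

  module T₀ = RootedTree up₀ toℕ up₀-measure
  open T₀ using () renaming (_≼_ to _≼₀_; _≼?_ to _≼₀?_; depth to depth₀)

  Adj⇒up₀ : ∀ {a b} → Adj T a b → up₀ a ≡ just b ⊎ up₀ b ≡ just a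
  Adj⇒up₀ (i , inj₁ (refl , refl)) = inj₁ refl
  Adj⇒up₀ (i , inj₂ (refl , refl)) = inj₂ refl

  up₀⇒Adj : ∀ {a b} → up₀ a ≡ just b → Adj T a b
  up₀⇒Adj {fsuc i} refl = i , inj₁ (refl , refl)

  zero-≼₀ : ∀ b → fzero ≼₀ b
  zero-≼₀ b with T₀.root-≼ b
  ... | fzero , _ , 0≼b = 0≼b

  -- Rerooting at c reverses the edges on the path from the old root 0 to c.
  up : Node T → Maybe (Node T)
  up u with u ≼₀? c
  ... | yes _ = T₀.branch u c
  ... | no _  = up₀ u

  measure : Node T → ℕ
  measure u with u ≼₀? c
  ... | yes _ = depth₀ c ∸ depth₀ u
  ... | no _  = depth₀ c + depth₀ u

  up-≼₀ : ∀ {u} → u ≼₀ c → up u ≡ T₀.branch u c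
  up-≼₀ {u} u≼c with u ≼₀? c
  ... | yes _  = refl
  ... | no u⋠c = contradiction u≼c u⋠c

  measure-≼₀ : ∀ {u} → u ≼₀ c → measure u ≡ depth₀ c ∸ depth₀ u
  measure-≼₀ {u} u≼c with u ≼₀? c
  ... | yes _  = refl
  ... | no u⋠c = contradiction u≼c u⋠c

  up-measure : ∀ {u p} → up u ≡ just p → measure p < measure u
  up-measure {u} {p} eq with u ≼₀? c
  ... | yes u≼c = subst (_< depth₀ c ∸ depth₀ u) (sym (measure-≼₀ p≼c))
                    (∸-monoʳ-< (T₀.up-depth p↑u) (T₀.≼-depth p≼c))
    where
      p↑u : up₀ p ≡ just u
      p↑u = proj₁ (T₀.branch-just eq)
      p≼c : p ≼₀ c
      p≼c = proj₂ (T₀.branch-just eq)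
  ... | no u⋠c with p ≼₀? c
  ...   | yes _ = ≤-<-trans (m∸n≤m (depth₀ c) (depth₀ p))
                            (m<m+n (depth₀ c) (≤-<-trans z≤n (T₀.up-depth eq)))
  ...   | no _  = +-monoʳ-< (depth₀ c) (T₀.up-depth eq)

  open RootedTree up measure (λ {u} {p} → up-measure {u} {p}) public

  up₀⇒up : ∀ {a b} → up₀ a ≡ just b → up a ≡ just b ⊎ up b ≡ just a
  up₀⇒up {a} {b} a↑b with a ≼₀? c
  ... | yes a≼c = inj₂ (trans (up-≼₀ b≼c) (T₀.branch-child a↑b a≼c))
    where
      b≼c : b ≼₀ c
      b≼c = T₀.≼-trans (T₀.there a↑b T₀.here) a≼c
  ... | no _    = inj₁ a↑b

  Adj⇒up : ∀ {a b} → Adj T a b → up a ≡ just b ⊎ up b ≡ just a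
  Adj⇒up adj with Adj⇒up₀ adj
  ... | inj₁ a↑b = up₀⇒up a↑b
  ... | inj₂ b↑a with up₀⇒up b↑a
  ...   | inj₁ e = inj₂ e
  ...   | inj₂ e = inj₁ e

  up⇒Adj : ∀ {a b} → up a ≡ just b → Adj T a b
  up⇒Adj {a} eq with a ≼₀? c
  ... | yes _ = Adj-sym {T} (up₀⇒Adj (proj₁ (T₀.branch-just eq)))
  ... | no _  = up₀⇒Adj eq

  up-root : ∀ {u} → up u ≡ nothing → u ≡ c
  up-root {u} eq with u ≼₀? c
  ... | yes u≼c with u ≟ c
  ...   | yes u≡c = u≡c
  ...   | no u≢c  = let x , x↑u , x≼c = T₀.≼-child u≼c u≢c in
                    contradiction (trans (sym eq) (T₀.branch-child x↑u x≼c)) λ ()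
  up-root {fzero} eq | no 0⋠c = contradiction (zero-≼₀ c) 0⋠c

  c-≼ : ∀ x → c ≼ x
  c-≼ x with root-≼ x
  ... | a , a-root , a≼x = subst (_≼ x) (up-root a-root) a≼x

  up-c : up c ≡ nothing
  up-c with T₀.branch c c in eq
  ... | nothing = trans (up-≼₀ T₀.here) eq
  ... | just a  = let a↑c , a≼c = T₀.branch-just eq in
                  ⊥-elim (<-irrefl refl (<-≤-trans (T₀.up-depth a↑c) (T₀.≼-depth a≼c)))

  depth-c : depth c ≡ 0
  depth-c = depth-root {c} up-c

  Adj-depth : ∀ {a b} → Adj T a b → depth b ≤ suc (depth a)
  Adj-depth {a} {b} adj with Adj⇒up adj
  ... | inj₁ a↑b = ≤-trans (n≤1+n _) (≤-trans (up-depth {a} a↑b) (n≤1+n _))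
  ... | inj₂ b↑a = ≤-reflexive (depth-up {b} b↑a)

  walk-depth : ∀ {P a b n} → Walk T P a b n → depth b ≤ depth a + n
  walk-depth {a = a} (here _) = ≤-reflexive (sym (+-identityʳ (depth a)))
  walk-depth {a = a} (step {n = n} _ adj w) =
    ≤-trans (walk-depth w) (≤-trans (+-monoˡ-≤ n (Adj-depth adj)) (≤-reflexive (sym (+-suc (depth a) n))))

  branch-Adj : ∀ {t x y} → Adj T x y → x ≢ t → y ≢ t → branch t x ≡ branch t y
  branch-Adj {t} {x} {y} adj x≢t y≢t with Adj⇒up adj
  ... | inj₁ x↑y = branch-up {t} {x} x↑y y≢t
  ... | inj₂ y↑x = sym (branch-up {t} {y} y↑x x≢t)

  branch-SameComp : ∀ {t x y} → SameComp T t x y → branch t x ≡ branch t y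
  branch-SameComp (_ , here _)          = refl
  branch-SameComp (_ , step x≢t adj w) = trans (branch-Adj adj x≢t (walk-start w)) (branch-SameComp (_ , w))

  leaf-childless : ∀ {l x} → Leaf T l → l ≢ c → up x ≡ just l → ⊥
  leaf-childless {l} {x} (_ , _ , only-b) l≢c x↑l with up l in eq
  ... | nothing = l≢c (up-root {l} eq)
  ... | just p with trans (only-b x (Adj-sym {T} (up⇒Adj {x} x↑l))) (sym (only-b p (up⇒Adj {l} eq)))
  ...   | refl = <-asym (up-measure {x} x↑l) (up-measure {l} eq)

Adj? : ∀ T a b → Dec (Adj T a b)
Adj? T a b = any? λ i → ((a ≟ fsuc i) ×-dec (b ≟ parent T i)) ⊎-dec ((b ≟ fsuc i) ×-dec (a ≟ parent T i))

Leaf? : ∀ T a → Dec (Leaf T a)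
Leaf? T a = any? λ b → Adj? T a b ×-dec all? λ x → Adj? T a x →-dec (x ≟ b)

walk-stays-in-pair : ∀ {T c d a b m} → (∀ x → Adj T c x → x ≡ d) → (∀ x → Adj T d x → x ≡ c) →
                     a ≡ c ⊎ a ≡ d → Walk T (λ _ → ⊤) a b m → b ≡ c ⊎ b ≡ d
walk-stays-in-pair only-d only-c a∈cd        (here _)       = a∈cd
walk-stays-in-pair only-d only-c (inj₁ refl) (step _ adj w) =
  walk-stays-in-pair only-d only-c (inj₂ (only-d _ adj)) w
walk-stays-in-pair only-d only-c (inj₂ refl) (step _ adj w) =
  walk-stays-in-pair only-d only-c (inj₁ (only-c _ adj)) w

InternalCentre : (T : Tree) → ℕ → Node T → Set
InternalCentre T r c = Internal T c × ∀ u → ∃ λ n → n ≤ r × Walk T (λ _ → ⊤) c u n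

-- If the centre is a leaf, its neighbour is an internal centre too (r > 0 pays for the extra step back).
internal-centre : ∀ T r → 0 < r → Σ (Node T) (Internal T) → RadiusAtMost T r →
                  Σ (Node T) (InternalCentre T r)
internal-centre T r r>0 (v , v-internal) (c , near) with Leaf? T c
... | no c-internal = c , c-internal , near
... | yes (d , c~d , only-d) = d , d-internal , near-d
  where
    near-d : ∀ u → ∃ λ m → m ≤ r × Walk T (λ _ → ⊤) d u m
    near-d u with near u
    ... | _ , _ , here _ = 1 , r>0 , step tt (Adj-sym {T} c~d) (here tt)
    ... | suc m , m<r , step {b = x} _ c~x w with only-d x c~x
    ...   | refl = m , <⇒≤ m<r , w
    d-internal : Internal T d
    d-internal (b , d~b , only-b) with only-b c (Adj-sym {T} c~d)
    ... | refl with walk-stays-in-pair {T} only-d only-b (inj₁ refl) (proj₂ (proj₂ (near v)))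
    ...   | inj₁ refl = v-internal (d , c~d , only-d)
    ...   | inj₂ refl = v-internal (c , d~b , only-b)

indicator : Bool → ℕ
indicator b = if b then 1 else 0

T⇒indicator : ∀ {b} → T b → 1 ≤ indicator b
T⇒indicator {true} _ = ≤-refl

sumSubsets : ∀ N → ((Fin N → Bool) → ℕ) → ℕ
sumSubsets zero    f = f (λ ())
sumSubsets (suc N) f = sumSubsets N (λ Y → f (false ∷ Y)) + sumSubsets N (λ Y → f (true ∷ Y))

sumSubsets-+ : ∀ N f g → sumSubsets N (λ Y → f Y + g Y) ≡ sumSubsets N f + sumSubsets N g
sumSubsets-+ zero    f g = refl
sumSubsets-+ (suc N) f g
  rewrite sumSubsets-+ N (λ Y → f (false ∷ Y)) (λ Y → g (false ∷ Y))
        | sumSubsets-+ N (λ Y → f (true ∷ Y)) (λ Y → g (true ∷ Y)) =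
  interchange (sumSubsets N (λ Y → f (false ∷ Y))) (sumSubsets N (λ Y → g (false ∷ Y)))
              (sumSubsets N (λ Y → f (true ∷ Y))) (sumSubsets N (λ Y → g (true ∷ Y)))

sumSubsets-mono : ∀ N {f g} → (∀ Y → f Y ≤ g Y) → sumSubsets N f ≤ sumSubsets N g
sumSubsets-mono zero    f≤g = f≤g _
sumSubsets-mono (suc N) f≤g = +-mono-≤ (sumSubsets-mono N λ _ → f≤g _) (sumSubsets-mono N λ _ → f≤g _)

sumSubsets-const : ∀ N c → sumSubsets N (λ _ → c) ≡ 2 ^ N * c
sumSubsets-const zero    c = sym (+-identityʳ c)
sumSubsets-const (suc N) c rewrite sumSubsets-const N c =
  sym (trans (*-assoc 2 (2 ^ N) c) (cong (2 ^ N * c +_) (+-identityʳ _)))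

flipAt : ∀ {N} → Fin N → (Fin N → Bool) → Fin N → Bool
flipAt fzero    Y = not (head Y) ∷ tail Y
flipAt (fsuc a) Y = head Y ∷ flipAt a (tail Y)

flipAt-self : ∀ {N} (a : Fin N) Y → flipAt a Y a ≡ not (Y a)
flipAt-self fzero    Y = refl
flipAt-self (fsuc a) Y = flipAt-self a (tail Y)

flipAt-other : ∀ {N} (a b : Fin N) Y → a ≢ b → flipAt a Y b ≡ Y b
flipAt-other fzero    fzero    Y a≢b = contradiction refl a≢b
flipAt-other fzero    (fsuc b) Y _   = refl
flipAt-other (fsuc a) fzero    Y _   = refl
flipAt-other (fsuc a) (fsuc b) Y a≢b = flipAt-other a b (tail Y) (a≢b ∘ cong fsuc)

-- Flipping one coordinate is an involution pairing up the subsets.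
sumSubsets-flip : ∀ N (a : Fin N) f → (∀ Y → 1 ≤ f Y + f (flipAt a Y)) → 2 ^ N ≤ 2 * sumSubsets N f
sumSubsets-flip (suc N) fzero f pair = *-monoʳ-≤ 2 (begin
  2 ^ N                                                    ≡⟨ *-identityʳ (2 ^ N) ⟨
  2 ^ N * 1                                                ≡⟨ sumSubsets-const N 1 ⟨
  sumSubsets N (λ _ → 1)                                   ≤⟨ sumSubsets-mono N (λ Y → pair (false ∷ Y)) ⟩
  sumSubsets N (λ Y → f (false ∷ Y) + f (true ∷ Y))        ≡⟨ sumSubsets-+ N _ _ ⟩
  sumSubsets (suc N) f                                     ∎)
  where open ≤-Reasoning
sumSubsets-flip (suc N) (fsuc a) f pair = begin
  2 ^ N + (2 ^ N + 0)                                      ≡⟨ cong (2 ^ N +_) (+-identityʳ _) ⟩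
  2 ^ N + 2 ^ N
    ≤⟨ +-mono-≤ (sumSubsets-flip N a _ λ Y → pair (false ∷ Y))
                (sumSubsets-flip N a _ λ Y → pair (true ∷ Y)) ⟩
  2 * sumSubsets N (λ Y → f (false ∷ Y)) + 2 * sumSubsets N (λ Y → f (true ∷ Y))
    ≡⟨ *-distribˡ-+ 2 (sumSubsets N (λ Y → f (false ∷ Y))) (sumSubsets N (λ Y → f (true ∷ Y))) ⟨
  2 * sumSubsets (suc N) f                                 ∎
  where open ≤-Reasoning

sumSubsets-bound : ∀ N {w} f → (∀ Y → f Y ≤ w) → (∀ Y → (∀ i → ¬ T (Y i)) → f Y ≡ 0) →
                   sumSubsets N f + w ≤ 2 ^ N * w
sumSubsets-bound zero    {w} f f≤w empty =
  ≤-reflexive (trans (cong (_+ w) (empty _ λ ())) (sym (+-identityʳ w)))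
sumSubsets-bound (suc N) {w} f f≤w empty = begin
  sumSubsets N f₀ + sumSubsets N f₁ + w     ≡⟨ xy∙z≈xz∙y (sumSubsets N f₀) (sumSubsets N f₁) w ⟩
  sumSubsets N f₀ + w + sumSubsets N f₁     ≤⟨ +-mono-≤ (sumSubsets-bound N f₀ (λ _ → f≤w _) empty₀)
                                                        (sumSubsets-mono N λ _ → f≤w _) ⟩
  2 ^ N * w + sumSubsets N (λ _ → w)
    ≡⟨ cong (2 ^ N * w +_) (trans (sumSubsets-const N w) (sym (+-identityʳ _))) ⟩
  2 ^ N * w + (2 ^ N * w + 0)               ≡⟨ *-assoc 2 (2 ^ N) w ⟨
  2 ^ suc N * w                             ∎
  where
    open ≤-Reasoning
    f₀ f₁ : (Fin N → Bool) → ℕ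
    f₀ Y = f (false ∷ Y)
    f₁ Y = f (true ∷ Y)
    empty₀ : ∀ Y → (∀ i → ¬ T (Y i)) → f₀ Y ≡ 0
    empty₀ Y none = empty (false ∷ Y) λ { fzero → λ () ; (fsuc i) → none i }

-- Double counting: sum over Y first, then over vertices.
count-sumSubsets : ∀ N k (S : Fin k → Bool) (p : (Fin N → Bool) → Fin k → Bool) →
  (∀ u → T (S u) → 2 ^ N ≤ 2 * sumSubsets N (λ Y → indicator (p Y u))) →
  countᵇ k S * 2 ^ N ≤ 2 * sumSubsets N (λ Y → countᵇ k (p Y))
count-sumSubsets N zero    S p each = z≤n
count-sumSubsets N (suc k) S p each = begin
  (indicator (S fzero) + countᵇ k (S ∘ fsuc)) * 2 ^ N
    ≡⟨ *-distribʳ-+ (2 ^ N) (indicator (S fzero)) _ ⟩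
  indicator (S fzero) * 2 ^ N + countᵇ k (S ∘ fsuc) * 2 ^ N
    ≤⟨ +-mono-≤ first (count-sumSubsets N k (S ∘ fsuc) (λ Y → p Y ∘ fsuc) (each ∘ fsuc)) ⟩
  2 * sumSubsets N (λ Y → indicator (p Y fzero)) + 2 * sumSubsets N (λ Y → countᵇ k (p Y ∘ fsuc))
    ≡⟨ *-distribˡ-+ 2 (sumSubsets N (λ Y → indicator (p Y fzero))) _ ⟨
  2 * (sumSubsets N (λ Y → indicator (p Y fzero)) + sumSubsets N (λ Y → countᵇ k (p Y ∘ fsuc)))
    ≡⟨ cong (2 *_) (sumSubsets-+ N _ _) ⟨
  2 * sumSubsets N (λ Y → countᵇ (suc k) (p Y))
    ∎
  where
    open ≤-Reasoning
    first : indicator (S fzero) * 2 ^ N ≤ 2 * sumSubsets N (λ Y → indicator (p Y fzero))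
    first with S fzero in eq
    ... | true  = ≤-trans (≤-reflexive (+-identityʳ _)) (each fzero (subst T (sym eq) tt))
    ... | false = z≤n

-- An edge with class nothing lies in no union of classes.
module TwoClasses (G : Graph) {N : ℕ} (class : Fin (nE G) → Maybe (Fin N)) where

  union : (Fin N → Bool) → EdgeSet G
  union Y e = Maybe.maybe Y false (class e)

  SeesTwoClasses : Fin (nV G) → Set
  SeesTwoClasses u = ∃₂ λ e e′ → ∃₂ λ a b →
    Incident G u e × Incident G u e′ × class e ≡ just a × class e′ ≡ just b × a ≢ b

  union-empty : ∀ {Y} e → (∀ i → ¬ T (Y i)) → ¬ T (union Y e)
  union-empty e none with class e
  ... | just a = none a

  boundary-split : ∀ {u e e′ a b} Y → Incident G u e → Incident G u e′ →
                   class e ≡ just a → class e′ ≡ just b → Y a ≡ true → Y b ≡ false →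
                   1 ≤ indicator (boundaryᵇ G (union Y) u)
  boundary-split Y ue ue′ ea e′b Ya Yb = T⇒indicator (boundary-intro G (union Y) ue
    (Equivalence.from T-≡ (trans (cong (Maybe.maybe Y false) ea) Ya)) ue′
    (Equivalence.from T-not-≡ (trans (cong (Maybe.maybe Y false) e′b) Yb)))

  boundary-or-flipped : ∀ {u e e′ a b} → Incident G u e → Incident G u e′ →
    class e ≡ just a → class e′ ≡ just b → a ≢ b → ∀ Y →
    1 ≤ indicator (boundaryᵇ G (union Y) u) + indicator (boundaryᵇ G (union (flipAt a Y)) u)
  boundary-or-flipped {a = a} {b} ue ue′ ea e′b a≢b Y with Y a in Ya | Y b in Yb
  ... | true  | false = ≤-trans (boundary-split Y ue ue′ ea e′b Ya Yb) (m≤m+n _ _)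
  ... | false | true  = ≤-trans (boundary-split Y ue′ ue e′b ea Yb Ya) (m≤m+n _ _)
  ... | true  | true  = ≤-trans (boundary-split (flipAt a Y) ue′ ue e′b ea
                                  (trans (flipAt-other a b Y a≢b) Yb) (trans (flipAt-self a Y) (cong not Ya)))
                                (m≤n+m _ _)
  ... | false | false = ≤-trans (boundary-split (flipAt a Y) ue ue′ ea e′b
                                  (trans (flipAt-self a Y) (cong not Ya)) (trans (flipAt-other a b Y a≢b) Yb))
                                (m≤n+m _ _)

  -- Averaging over all unions: each such vertex is a boundary vertex of at least half of them,
  -- while the total is at most (2 ^ N - 1) w because the empty union has no boundary.
  seesTwoClasses-count< : ∀ {w} → 0 < w → (∀ Y → λG G (union Y) ≤ w) →
    (S : Fin (nV G) → Bool) → (∀ u → T (S u) → SeesTwoClasses u) → countᵇ (nV G) S < 2 * w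
  seesTwoClasses-count< {suc w} _ small S sees = ≰⇒> λ 2w≤count → m+1+n≰m (2 * Σλ) (begin
    2 * Σλ + 2 * suc w        ≡⟨ *-distribˡ-+ 2 Σλ (suc w) ⟨
    2 * (Σλ + suc w)          ≤⟨ *-monoʳ-≤ 2 upper ⟩
    2 * (2 ^ N * suc w)       ≡⟨ cong (2 *_) (*-comm (2 ^ N) (suc w)) ⟩
    2 * (suc w * 2 ^ N)       ≡⟨ *-assoc 2 (suc w) (2 ^ N) ⟨
    2 * suc w * 2 ^ N         ≤⟨ *-monoˡ-≤ (2 ^ N) 2w≤count ⟩
    countᵇ (nV G) S * 2 ^ N   ≤⟨ lower ⟩
    2 * Σλ                    ∎)
    where
      open ≤-Reasoning
      Σλ : ℕ
      Σλ = sumSubsets N (λ Y → λG G (union Y))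
      each : ∀ u → T (S u) → 2 ^ N ≤ 2 * sumSubsets N (λ Y → indicator (boundaryᵇ G (union Y) u))
      each u Su with sees u Su
      ... | e , e′ , a , b , ue , ue′ , ea , e′b , a≢b =
        sumSubsets-flip N a _ (boundary-or-flipped ue ue′ ea e′b a≢b)
      lower : countᵇ (nV G) S * 2 ^ N ≤ 2 * Σλ
      lower = count-sumSubsets N (nV G) S (λ Y → boundaryᵇ G (union Y)) each
      upper : Σλ + suc w ≤ 2 ^ N * suc w
      upper = sumSubsets-bound N _ small λ Y none → λG-empty G (union Y) (λ e → union-empty e none)

0<2*w∸1 : ∀ {w} → 0 < w → 0 < 2 * w ∸ 1
0<2*w∸1 {suc w} _ = ≤-trans (s≤s z≤n) (m≤n+m (suc (w + 0)) w)

module Construction (G : Graph) (D : Decomposition G) (w r : ℕ) (w>0 : 0 < w) (r>0 : 0 < r)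
  (narrow : ∀ t → Internal (tree D) t → NodeWidthAtMost G D t w)
  (c : Node (tree D)) (centre : InternalCentre (tree D) r c) where

  open Rerooted (tree D) c

  Vertex Edge TreeNode : Set
  Vertex   = Fin (nV G)
  Edge     = Fin (nE G)
  TreeNode = Node (tree D)

  leaf≢c : ∀ e → σ D e ≢ c
  leaf≢c e eq = proj₁ centre (subst (Leaf (tree D)) eq (σ-leaf D e))

  σ-childless : ∀ {x} e → up x ≡ just (σ D e) → ⊥
  σ-childless {x} e = leaf-childless {σ D e} {x} (σ-leaf D e) (leaf≢c e)

  depth≤r : ∀ u → depth u ≤ r
  depth≤r u with proj₂ centre u
  ... | n , n≤r , walk = ≤-trans (walk-depth walk) (≤-trans (≤-reflexive (cong (_+ n) depth-c)) n≤r)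

  Hub : Vertex → Set
  Hub v = ∃₂ λ e e′ → e ≢ e′ × Incident G v e × Incident G v e′

  Hub? : ∀ v → Dec (Hub v)
  Hub? v = any? λ e → any? λ e′ → ¬? (e ≟ e′) ×-dec Incident? G v e ×-dec Incident? G v e′

  nonHub-edge-unique : ∀ {v e e′} → ¬ Hub v → Incident G v e → Incident G v e′ → e ≡ e′
  nonHub-edge-unique {e = e} {e′} ¬hub ve ve′ with e ≟ e′
  ... | yes eq  = eq
  ... | no e≢e′ = contradiction (e , e′ , e≢e′ , ve , ve′) ¬hub

  nonHub-neighbour-unique : ∀ {v x y e e′} → ¬ Hub v → Incident G v e → Incident G x e → x ≢ v →
                            Incident G v e′ → Incident G y e′ → y ≢ v → x ≡ y
  nonHub-neighbour-unique ¬hub ve xe x≢v ve′ ye′ y≢v with nonHub-edge-unique ¬hub ve′ ve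
  ... | refl = incident-third G xe ve ye′ x≢v y≢v

  AboveAll : Vertex → TreeNode → Set
  AboveAll v t = ∀ e → Incident G v e → t ≼ σ D e

  AboveAll? : ∀ v t → Dec (AboveAll v t)
  AboveAll? v t = all? λ e → Incident? G v e →-dec (t ≼? σ D e)

  -- The deepest node lying above every leaf of an edge at v (for isolated v it is irrelevant).
  -- Kept opaque: only top-above and top-deepest are used, and unfolding top is expensive.
  opaque
    top : Vertex → TreeNode
    top v = Maximum.arg (maximum (AboveAll? v) depth (c , λ e _ → c-≼ (σ D e)))

    top-above : ∀ v → AboveAll v (top v)
    top-above v = Maximum.holds (maximum (AboveAll? v) depth (c , λ e _ → c-≼ (σ D e)))

    top-deepest : ∀ {v t} → AboveAll v t → depth t ≤ depth (top v)
    top-deepest {v} = Maximum.maximal (maximum (AboveAll? v) depth (c , λ e _ → c-≼ (σ D e)))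

  nonHub-top : ∀ {v e} → ¬ Hub v → Incident G v e → top v ≡ σ D e
  nonHub-top {v} {e} ¬hub ve = ≼-depth-injective (top-above v e ve)
    (≤-antisym (≼-depth (top-above v e ve))
               (top-deepest λ f vf → subst (λ g → σ D e ≼ σ D g) (nonHub-edge-unique ¬hub ve vf) here))

  leaf-≼ : ∀ f {x} → σ D f ≼ x → x ≡ σ D f
  leaf-≼ f here            = refl
  leaf-≼ f {x} (there x↑p σf≼p) =
    ⊥-elim (σ-childless {x} f (subst (λ p → up x ≡ just p) (leaf-≼ f σf≼p) x↑p))

  hub-top≢leaf : ∀ {v} f → Hub v → top v ≢ σ D f
  hub-top≢leaf {v} f (e , e′ , e≢e′ , ve , ve′) top≡σf = e≢e′ (trans (is-f e ve) (sym (is-f e′ ve′)))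
    where
      is-f : ∀ g → Incident G v g → g ≡ f
      is-f g vg = σ-injective D (leaf-≼ f (subst (_≼ σ D g) top≡σf (top-above v g vg)))

  hub-top-child : ∀ {v} → Hub v → ∃ λ x → up x ≡ just (top v)
  hub-top-child {v} hub@(e , _ , _ , ve , _) =
    let x , x↑top , _ = ≼-child (top-above v e ve) (hub-top≢leaf e hub) in x , x↑top

  hub-top-internal : ∀ {v} → Hub v → Internal (tree D) (top v)
  hub-top-internal {v} hub top-leaf with top v ≟ c
  ... | yes top≡c = proj₁ centre (subst (Leaf (tree D)) top≡c top-leaf)
  ... | no top≢c  = let x , x↑top = hub-top-child hub in leaf-childless {top v} {x} top-leaf top≢c x↑top

  hub-top-depth : ∀ {v} → Hub v → depth (top v) < r
  hub-top-depth hub = let x , x↑top = hub-top-child hub in <-≤-trans (up-depth {x} x↑top) (depth≤r x)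

  classAt : TreeNode → Edge → Maybe TreeNode
  classAt t e = branch t (σ D e)

  open TwoClasses G using (union; SeesTwoClasses; seesTwoClasses-count<)

  classAt-narrow : ∀ t → Internal (tree D) t → ∀ Y → λG G (union (classAt t) Y) ≤ w
  classAt-narrow t internal Y =
    narrow t internal (union (classAt t) Y) λ e e′ same → cong (Maybe.maybe Y false) (branch-SameComp same)

  -- Otherwise the branch below top v containing one leaf of v would contain all of them.
  hub-sees-two-classes : ∀ {v} → Hub v → SeesTwoClasses (classAt (top v)) v
  hub-sees-two-classes {v} hub@(e , _ , _ , ve , _) with branch-below (top-above v e ve) (hub-top≢leaf e hub)
  ... | a , ea with any? (λ f → Incident? G v f ×-dec ¬? (≡-dec-Maybe _≟_ (classAt (top v) f) (just a)))
  ...   | yes (f , vf , f∉a) =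
    let b , fb = branch-below (top-above v f vf) (hub-top≢leaf f hub)
    in e , f , a , b , ve , vf , ea , fb , λ a≡b → f∉a (trans fb (cong just (sym a≡b)))
  ...   | no all-in-a =
    ⊥-elim (<-irrefl refl (<-≤-trans (up-depth {a} (proj₁ (branch-just ea))) (top-deepest a-above)))
    where
      a-above : AboveAll v a
      a-above f vf = proj₂ (branch-just (decidable-stable (≡-dec-Maybe _≟_ (classAt (top v) f) (just a))
                                                          λ f∉a → all-in-a (f , vf , f∉a)))

  hubAtᵇ : TreeNode → Vertex → Bool
  hubAtᵇ t x = ⌊ Hub? x ⌋ ∧ ⌊ top x ≟ t ⌋

  hubAt-intro : ∀ {t x} → Hub x → top x ≡ t → T (hubAtᵇ t x)
  hubAt-intro {t} {x} hub eq = Equivalence.from (T-∧ {⌊ Hub? x ⌋} {⌊ top x ≟ t ⌋})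
    (fromWitness {a? = Hub? x} hub , fromWitness {a? = top x ≟ t} eq)

  hubAt-elim : ∀ {t x} → T (hubAtᵇ t x) → Hub x × top x ≡ t
  hubAt-elim {t} {x} h = let hub , eq = Equivalence.to (T-∧ {⌊ Hub? x ⌋} {⌊ top x ≟ t ⌋}) h
                         in toWitness {a? = Hub? x} hub , toWitness {a? = top x ≟ t} eq

  hubBeforeᵇ : TreeNode → Vertex → Vertex → Bool
  hubBeforeᵇ t v x = ⌊ toℕ x <? toℕ v ⌋ ∧ hubAtᵇ t x

  hubBefore-intro : ∀ {t v x} → toℕ x < toℕ v → T (hubAtᵇ t x) → T (hubBeforeᵇ t v x)
  hubBefore-intro {t} {v} {x} x<v at =
    Equivalence.from (T-∧ {⌊ toℕ x <? toℕ v ⌋} {hubAtᵇ t x}) (fromWitness {a? = toℕ x <? toℕ v} x<v , at)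

  hubBefore-elim : ∀ {t v x} → T (hubBeforeᵇ t v x) → toℕ x < toℕ v × T (hubAtᵇ t x)
  hubBefore-elim {t} {v} {x} h = let x<v , at = Equivalence.to (T-∧ {⌊ toℕ x <? toℕ v ⌋} {hubAtᵇ t x}) h
                                 in toWitness {a? = toℕ x <? toℕ v} x<v , at

  W L : ℕ
  W = 2 * w ∸ 1
  L = W * r

  hubsAt-count : ∀ {v} → Hub v → countᵇ (nV G) (hubAtᵇ (top v)) ≤ W
  hubsAt-count {v} hub = ≤-trans (suc[m]≤n⇒m≤pred[n] fewer) (≤-reflexive (pred[m∸n]≡m∸[1+n] (2 * w) 0))
    where
      sees : ∀ x → T (hubAtᵇ (top v) x) → SeesTwoClasses (classAt (top v)) x
      sees x h = let hub , eq = hubAt-elim h in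
                 subst (λ t → SeesTwoClasses (classAt t) x) eq (hub-sees-two-classes hub)
      fewer : countᵇ (nV G) (hubAtᵇ (top v)) < 2 * w
      fewer = seesTwoClasses-count< (classAt (top v)) w>0 (classAt-narrow (top v) (hub-top-internal hub))
                                    (hubAtᵇ (top v)) sees

  slot : Vertex → ℕ
  slot v = countᵇ (nV G) (hubBeforeᵇ (top v) v)

  slot-mono : ∀ {u v} → Hub u → top u ≡ top v → toℕ u < toℕ v → slot u < slot v
  slot-mono {u} {v} hub eq u<v = countᵇ-strict (nV G) earlier u
    (λ h → <-irrefl refl (proj₁ (hubBefore-elim {top u} {u} {u} h))) (hubBefore-intro u<v (hubAt-intro hub eq))
    where
      earlier : ∀ x → T (hubBeforeᵇ (top u) u x) → T (hubBeforeᵇ (top v) v x)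
      earlier x h = let x<u , at = hubBefore-elim {top u} {u} {x} h in
        hubBefore-intro (<-trans x<u u<v) (subst (λ t → T (hubAtᵇ t x)) eq at)

  slot<W : ∀ {v} → Hub v → slot v < W
  slot<W {v} hub = <-≤-trans
    (countᵇ-strict (nV G) (λ x h → proj₂ (hubBefore-elim {top v} {v} {x} h)) v
                   (λ h → <-irrefl refl (proj₁ (hubBefore-elim {top v} {v} {v} h))) (hubAt-intro hub refl))
    (hubsAt-count hub)

  level : Vertex → ℕ
  level v = depth (top v) * W + slot v

  level<depth : ∀ {v d} → Hub v → depth (top v) < d → level v < d * W
  level<depth {v} {d} hub dv<d = begin-strict
    depth (top v) * W + slot v   <⟨ +-monoʳ-< (depth (top v) * W) (slot<W hub) ⟩
    depth (top v) * W + W        ≡⟨ +-comm (depth (top v) * W) W ⟩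
    suc (depth (top v)) * W      ≤⟨ *-monoˡ-≤ W dv<d ⟩
    d * W                        ∎
    where open ≤-Reasoning

  level<L : ∀ {v} → Hub v → level v < L
  level<L {v} hub = <-≤-trans (level<depth hub (hub-top-depth hub)) (≤-reflexive (*-comm r W))

  level-depth : ∀ {u v} → Hub u → Hub v → level u ≤ level v → depth (top u) ≤ depth (top v)
  level-depth {u} {v} hub-u hub-v lu≤lv with depth (top u) ≤? depth (top v)
  ... | yes du≤dv = du≤dv
  ... | no du≰dv  = ⊥-elim (<-irrefl refl (≤-<-trans lu≤lv (<-≤-trans (level<depth hub-v (≰⇒> du≰dv))
                                                                        (m≤m+n (depth (top u) * W) (slot u)))))

  level-injective : ∀ {u v t} → Hub u → Hub v → top u ≼ t → top v ≼ t → level u ≡ level v → u ≡ v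
  level-injective {u} {v} hub-u hub-v u≼t v≼t eq = by-index (<-cmp (toℕ u) (toℕ v))
    where
      same-depth : depth (top u) ≡ depth (top v)
      same-depth = ≤-antisym (level-depth hub-u hub-v (≤-reflexive eq))
                             (level-depth hub-v hub-u (≤-reflexive (sym eq)))
      same-top : top u ≡ top v
      same-top = ≼-unique u≼t v≼t same-depth
      same-slot : slot u ≡ slot v
      same-slot = +-cancelˡ-≡ (depth (top u) * W) (slot u) (slot v)
                    (trans eq (cong (λ d → d * W + slot v) (sym same-depth)))
      by-index : Tri (toℕ u < toℕ v) (toℕ u ≡ toℕ v) (toℕ v < toℕ u) → u ≡ v
      by-index (tri≈ _ u≡v _) = toℕ-injective u≡v
      by-index (tri< u<v _ _) = ⊥-elim (<-irrefl same-slot (slot-mono hub-u same-top u<v))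
      by-index (tri> _ _ v<u) = ⊥-elim (<-irrefl (sym same-slot) (slot-mono hub-v (sym same-top) v<u))

  index<⇒≢ : ∀ {u v : Vertex} → toℕ u < toℕ v → u ≢ v
  index<⇒≢ u<v u≡v = <-irrefl (cong toℕ u≡v) u<v

  -- The ends of an edge meeting no other edge; they are kept apart from the hubs.
  PendantPair : Vertex → Vertex → Set
  PendantPair u v = ¬ Hub u × ¬ Hub v × toℕ u < toℕ v × ∃ λ e → Incident G u e × Incident G v e

  PendantPair? : ∀ u v → Dec (PendantPair u v)
  PendantPair? u v = ¬? (Hub? u) ×-dec ¬? (Hub? v) ×-dec (toℕ u <? toℕ v) ×-dec
                     any? (λ e → Incident? G u e ×-dec Incident? G v e)

  pendantPair-unique : ∀ {u u′ v} → PendantPair u v → PendantPair u′ v → u ≡ u′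
  pendantPair-unique (_ , ¬hub , u<v , e , ue , ve) (_ , _ , u′<v , e′ , u′e′ , ve′) =
    nonHub-neighbour-unique ¬hub ve ue (index<⇒≢ u<v) ve′ u′e′ (index<⇒≢ u′<v)

  pendantPair-not-chained : ∀ {u v x} → PendantPair u v → ¬ PendantPair v x
  pendantPair-not-chained (_ , ¬hub , u<v , e , ue , ve) (_ , _ , v<x , e′ , ve′ , xe′)
    with nonHub-neighbour-unique ¬hub ve ue (index<⇒≢ u<v) ve′ xe′ (λ x≡v → index<⇒≢ v<x (sym x≡v))
  ... | refl = <-asym u<v v<x

  rank : Vertex → ℕ
  rank v with Hub? v
  ... | yes _ = level v
  ... | no _ with any? (PendantPair? v)
  ...   | yes _ = 0
  ...   | no _  = L

  rank-hub : ∀ {v} → Hub v → rank v ≡ level v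
  rank-hub {v} hub with Hub? v
  ... | yes _   = refl
  ... | no ¬hub = contradiction hub ¬hub

  rank-lower : ∀ {v x} → PendantPair v x → rank v ≡ 0
  rank-lower {v} p@(¬hub , _) with Hub? v
  ... | yes hub = contradiction hub ¬hub
  ... | no _ with any? (PendantPair? v)
  ...   | yes _  = refl
  ...   | no none = contradiction (_ , p) none

  rank-pendant : ∀ {v} → ¬ Hub v → ¬ ∃ (PendantPair v) → rank v ≡ L
  rank-pendant {v} ¬hub no-pair with Hub? v
  ... | yes hub = contradiction hub ¬hub
  ... | no _ with any? (PendantPair? v)
  ...   | yes pair = contradiction pair no-pair
  ...   | no _     = refl

  rank≤L : ∀ v → rank v ≤ L
  rank≤L v with Hub? v
  ... | yes hub = <⇒≤ (level<L hub)
  ... | no _ with any? (PendantPair? v)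
  ...   | yes _ = z≤n
  ...   | no _  = ≤-refl

  0<L : 0 < L
  0<L = *-mono-≤ (0<2*w∸1 w>0) r>0

  HubBelow : Vertex → Vertex → Set
  HubBelow u v = Hub u × ¬ ∃ (λ x → PendantPair x v) × top u ≼ top v × rank u < rank v

  data _≺_ (u v : Vertex) : Set where
    hub-below     : HubBelow u v → u ≺ v
    pendant-below : PendantPair u v → u ≺ v

  _≺?_ : ∀ u v → Dec (u ≺ v)
  u ≺? v = map′ [ hub-below , pendant-below ] (λ { (hub-below h) → inj₁ h ; (pendant-below p) → inj₂ p })
    ((Hub? u ×-dec ¬? (any? λ x → PendantPair? x v) ×-dec top u ≼? top v ×-dec rank u <? rank v)
     ⊎-dec PendantPair? u v)

  ≺-rank : ∀ {u v} → u ≺ v → rank u < rank v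
  ≺-rank (hub-below (_ , _ , _ , u<v)) = u<v
  ≺-rank (pendant-below pair@(_ , ¬hub , _)) = subst₂ _<_ (sym (rank-lower pair))
    (sym (rank-pendant ¬hub λ (_ , pair′) → pendantPair-not-chained pair pair′)) 0<L

  hub-below-hub : ∀ {u v t} → Hub u → Hub v → top u ≼ t → top v ≼ t → level u < level v → u ≺ v
  hub-below-hub hub-u hub-v u≼t v≼t lu<lv =
    hub-below (hub-u , (λ (_ , pair) → proj₁ (proj₂ pair) hub-v) ,
               ≼-chain u≼t v≼t (level-depth hub-u hub-v (<⇒≤ lu<lv)) ,
               subst₂ _<_ (sym (rank-hub hub-u)) (sym (rank-hub hub-v)) lu<lv)

  hubs-comparable : ∀ {u v t} → Hub u → Hub v → top u ≼ t → top v ≼ t → u ≺ v ⊎ u ≡ v ⊎ v ≺ u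
  hubs-comparable {u} {v} hub-u hub-v u≼t v≼t with <-cmp (level u) (level v)
  ... | tri< lu<lv _ _ = inj₁ (hub-below-hub hub-u hub-v u≼t v≼t lu<lv)
  ... | tri≈ _ lu≡lv _ = inj₂ (inj₁ (level-injective hub-u hub-v u≼t v≼t lu≡lv))
  ... | tri> _ _ lv<lu = inj₂ (inj₂ (hub-below-hub hub-v hub-u v≼t u≼t lv<lu))

  ≺-chain : ∀ {u u′ v} → u ≺ v → u′ ≺ v → u ≺ u′ ⊎ u ≡ u′ ⊎ u′ ≺ u
  ≺-chain (hub-below (hub , _ , u≼v , _)) (hub-below (hub′ , _ , u′≼v , _)) = hubs-comparable hub hub′ u≼v u′≼v
  ≺-chain (hub-below (_ , no-pair , _)) (pendant-below pair′) = ⊥-elim (no-pair (_ , pair′))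
  ≺-chain (pendant-below pair) (hub-below (_ , no-pair , _))  = ⊥-elim (no-pair (_ , pair))
  ≺-chain (pendant-below pair) (pendant-below pair′)          = inj₂ (inj₁ (pendantPair-unique pair pair′))

  hub-below-pendant : ∀ {u v e} → Hub u → ¬ Hub v → Incident G u e → Incident G v e → u ≢ v → u ≺ v
  hub-below-pendant {u} {v} {e} hub ¬hub ue ve u≢v =
    hub-below (hub , no-upper , subst (top u ≼_) (sym (nonHub-top ¬hub ve)) (top-above u e ue) ,
               subst₂ _<_ (sym (rank-hub hub)) (sym (rank-pendant ¬hub no-lower)) (level<L hub))
    where
      partner-is-u : ∀ {x e′} → Incident G x e′ → Incident G v e′ → x ≢ v → x ≡ u
      partner-is-u xe′ ve′ x≢v = nonHub-neighbour-unique ¬hub ve′ xe′ x≢v ve ue u≢v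
      no-upper : ¬ ∃ (λ x → PendantPair x v)
      no-upper (x , ¬hub-x , _ , x<v , _ , xe′ , ve′) =
        ¬hub-x (subst Hub (sym (partner-is-u xe′ ve′ (index<⇒≢ x<v))) hub)
      no-lower : ¬ ∃ (PendantPair v)
      no-lower (x , _ , ¬hub-x , v<x , _ , ve′ , xe′) =
        ¬hub-x (subst Hub (sym (partner-is-u xe′ ve′ (λ x≡v → index<⇒≢ v<x (sym x≡v)))) hub)

  incident-comparable : ∀ {x y e} → Incident G x e → Incident G y e → x ≢ y → x ≺ y ⊎ y ≺ x
  incident-comparable {x} {y} {e} xe ye x≢y with Hub? x | Hub? y
  ... | yes hub-x | yes hub-y with hubs-comparable hub-x hub-y (top-above x e xe) (top-above y e ye)
  ...   | inj₁ x≺y        = inj₁ x≺y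
  ...   | inj₂ (inj₁ x≡y) = contradiction x≡y x≢y
  ...   | inj₂ (inj₂ y≺x) = inj₂ y≺x
  incident-comparable xe ye x≢y | yes hub-x | no ¬hub-y = inj₁ (hub-below-pendant hub-x ¬hub-y xe ye x≢y)
  incident-comparable xe ye x≢y | no ¬hub-x | yes hub-y = inj₂ (hub-below-pendant hub-y ¬hub-x ye xe (x≢y ∘ sym))
  incident-comparable {x} {y} {e} xe ye x≢y | no ¬hub-x | no ¬hub-y with <-cmp (toℕ x) (toℕ y)
  ...   | tri< x<y _ _ = inj₁ (pendant-below (¬hub-x , ¬hub-y , x<y , e , xe , ye))
  ...   | tri≈ _ x≡y _ = contradiction (toℕ-injective x≡y) x≢y
  ...   | tri> _ _ y<x = inj₂ (pendant-below (¬hub-y , ¬hub-x , y<x , e , ye , xe))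

  order : TreeOrder (nV G) (L + 1)
  order = record
    { _≺_     = _≺_
    ; _≺?_    = _≺?_
    ; rank    = rank
    ; rank<   = λ v → ≤-<-trans (rank≤L v) (m<m+n L (s≤s z≤n))
    ; ≺-rank  = ≺-rank
    ; ≺-chain = ≺-chain
    }

  treeDepth : TreeDepthAtMost G (L + 1)
  treeDepth = treeDepth-of-treeOrder G order λ e →
    incident-comparable (end₁-incident G e) (end₂-incident G e)

lemma3p4 : (r w : ℕ) → 0 < r → 0 < w → (G : Graph) →
    HasWRDecomposition G w r → TreeDepthAtMost G ((2 * w ∸ 1) * r + 1)
lemma3p4 r w r>0 w>0 G (D , narrow , radius) =
  let c , centre = internal-centre (tree D) r r>0 (hasInternal D) radius
  in Construction.treeDepth G D w r w>0 r>0 narrow c centre
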